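{- Let $k\ge1$ be an integer and $z$ an indeterminate. For every $n\ge 1$, in $\mathbb{Q}(z)$, $$\sum_{T\in T_k(n)}\prod_{h\in\mathcal{H}(T)}\frac{\prod_{i=1}^{h-1}(kh+z-i)}{kh\prod_{i=1}^{h-2}\big(kh+k(z-1)-i\big)}=\frac{z}{n!}\prod_{i=1}^{n-1}(kn+z-i).$$
   Context: A $k$-ary tree is an ordered rooted unlabeled tree in which every vertex has exactly $k$ subtrees in linear order, where a subtree is allowed to be empty; $T_k(n)$ is the set of $k$-ary trees with $n$ vertices. For a vertex $u$ of a tree $T$, the hook length $h_u$ is the number of descendants of $u$ (counting $u$ itself), and $\mathcal{H}(T)$ is the multiset of hook lengths of the vertices of $T$; the product over $\mathcal{H}(T)$ is the product over all vertices. Product convention: $\prod_{i=1}^{m}c_i$ is the ordinary product for $m\ge1$, equals $1$ for $m=0$, and for $m=-1$ equals $1/c_0$ where $c_0$ is the factor evaluated at $i=0$ (so for $h=1$, $\prod_{i=1}^{ -1}(kh+k(z-1)-i)=1/(kz)$). -}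

module Defs where

open import Data.Nat as ℕ using (ℕ; zero; suc; _∸_)
open import Data.Nat using (_!)
open import Data.Integer using (+_)
open import Data.Rational using (ℚ; 0ℚ; 1ℚ; _/_) renaming (_+_ to _+q_; _*_ to _*q_; -_ to -q_)
open import Data.List using (List; []; _∷_; map; foldr)
open import Data.List.Relation.Unary.All using (All)
open import Data.Vec using (Vec; []; _∷_)
open import Relation.Binary.PropositionalEquality using (_≡_)

-- k-ary trees.  'empty' is the empty subtree (not a vertex);
-- 'node ts' is a vertex with exactly k (ordered, possibly empty) subtrees.

data KTree (k : ℕ) : Set where
  empty : KTree k
  node  : Vec (KTree k) k → KTree k

mutual
  size : ∀ {k} → KTree k → ℕ
  size empty     = 0
  size (node ts) = suc (sizes ts)

  sizes : ∀ {k m} → Vec (KTree k) m → ℕ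
  sizes []       = 0
  sizes (t ∷ ts) = size t ℕ.+ sizes ts

-- Polynomials in ℚ[z]: coefficient lists, constant term first.

Poly : Set
Poly = List ℚ

_+P_ : Poly → Poly → Poly
[]      +P q       = q
(a ∷ p) +P []      = a ∷ p
(a ∷ p) +P (b ∷ q) = (a +q b) ∷ (p +P q)

negP : Poly → Poly
negP = map -q_

_*P_ : Poly → Poly → Poly
[]      *P q = []
(a ∷ p) *P q = map (a *q_) q +P (0ℚ ∷ (p *P q))

cst : ℕ → Poly
cst m = ((+ m) / 1) ∷ []

lin : ℕ → ℕ → Poly
lin c a = ((+ c) / 1) ∷ ((+ a) / 1) ∷ []

_≈P_ : Poly → Poly → Set
p ≈P q = All (_≡ 0ℚ) (p +P negP q)

-- ℚ(z) as the field of fractions of ℚ[z]: pairs num/den, compared by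
-- cross-multiplication.  (All denominators built below are nonzero.)

record RatFun : Set where
  constructor _⁄_
  field
    num : Poly
    den : Poly
open RatFun public

_+R_ : RatFun → RatFun → RatFun
(a ⁄ b) +R (c ⁄ d) = ((a *P d) +P (c *P b)) ⁄ (b *P d)

_*R_ : RatFun → RatFun → RatFun
(a ⁄ b) *R (c ⁄ d) = (a *P c) ⁄ (b *P d)

0R 1R : RatFun
0R = cst 0 ⁄ cst 1
1R = cst 1 ⁄ cst 1

_≈R_ : RatFun → RatFun → Set
(a ⁄ b) ≈R (c ⁄ d) = (a *P d) ≈P (c *P b)

sumR : List RatFun → RatFun
sumR = foldr _+R_ 0R

prodRange : ℕ → ℕ → (ℕ → Poly) → Poly
prodRange lo zero    f = cst 1
prodRange lo (suc m) f = f lo *P prodRange (suc lo) m f   -- m factors starting at lo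

prod1 : ℕ → (ℕ → Poly) → Poly
prod1 m f = prodRange 1 m f

-- Note kh - i ≥ 1 for i ≤ h-1 and kh+k(z-1)-i = (kh-k-i) + kz with
-- kh-k-i ≥ 1 for i ≤ h-2, so truncated subtraction ∸ is exact here.
-- For h = 1 the convention ∏_{i=1}^{-1} c_i = 1/c_0 = 1/(kz) gives
-- denominator k·1·(1/(kz)), so the factor is (1·kz)/(k·1).

hookFactor : ℕ → ℕ → RatFun
hookFactor k zero          = 1R   -- never used (hook lengths are ≥ 1)
hookFactor k (suc zero)    = (cst 1 *P lin 0 k) ⁄ cst (k ℕ.* 1)
hookFactor k (suc (suc m)) =
  let h = suc (suc m) in
  prod1 (suc m) (λ i → lin (k ℕ.* h ∸ i) 1)
  ⁄ (cst (k ℕ.* h) *P prod1 m (λ i → lin (k ℕ.* h ∸ k ∸ i) k))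

mutual
  hookProd : ∀ {k} → KTree k → RatFun
  hookProd empty             = 1R
  hookProd {k} t@(node ts)   = hookFactor k (size t) *R hookProds ts

  hookProds : ∀ {k m} → Vec (KTree k) m → RatFun
  hookProds []       = 1R
  hookProds (t ∷ ts) = hookProd t *R hookProds ts

rhs : ℕ → ℕ → RatFun
rhs k n = (lin 0 1 *P prod1 (n ∸ 1) (λ i → lin (k ℕ.* n ∸ i) 1)) ⁄ cst (n !)

module Submission where

open import Defs
open import Data.Nat using (ℕ; suc; _≤_)
open import Data.List using (List; map)
open import Data.List.Membership.Propositional using (_∈_)
open import Data.List.Relation.Unary.Unique.Propositional using (Unique)
open import Data.Product using (_,_)
open import Function.Bundles using (_⇔_)
open import Relation.Binary.PropositionalEquality using (_≡_)

-- Both sides are rational functions of z, so it suffices that they agree at every positive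
-- integer z = x, where all the denominators involved are positive integers.  At z = x the
-- weighted count of k-ary trees of size n is the forest number
-- c(n, x) = (x / n!) ∏_{i=1}^{n-1} (kn + x - i), the number of k-ary forests of x trees with
-- n vertices.  Indeed these numbers satisfy c(m, x + y) = Σ_{a+b=m} c(a, x) c(b, y), so
-- deleting the root of a tree of size m + 1 turns the sum into c(m, kx) times the hook factor
-- of m + 1, and that factor equals c(m + 1, x) / c(m, kx).

module NatOperators where

  open import Data.Nat
  open import Data.Nat.Properties
  open import Relation.Binary.PropositionalEquality
  open import Data.Nat.Solver using (module +-*-Solver)
  open +-*-Solver
  open ≡-Reasoning

  prodRangeℕ : ℕ → ℕ → (ℕ → ℕ) → ℕ
  prodRangeℕ lo zero    f = 1
  prodRangeℕ lo (suc m) f = f lo * prodRangeℕ (suc lo) m f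

  prodRangeℕ-shift : ∀ lo m f → prodRangeℕ (suc lo) m f ≡ prodRangeℕ lo m (λ i → f (suc i))
  prodRangeℕ-shift lo zero    f = refl
  prodRangeℕ-shift lo (suc m) f = cong (f (suc lo) *_) (prodRangeℕ-shift (suc lo) m f)

  prodRangeℕ-snoc : ∀ lo m f → prodRangeℕ lo (suc m) f ≡ prodRangeℕ lo m f * f (lo + m)
  prodRangeℕ-snoc lo zero    f = begin
    f lo * 1        ≡⟨ *-identityʳ (f lo) ⟩
    f lo            ≡⟨ cong f (+-identityʳ lo) ⟨
    f (lo + 0)      ≡⟨ *-identityˡ _ ⟨
    1 * f (lo + 0)  ∎
  prodRangeℕ-snoc lo (suc m) f = begin
    f lo * prodRangeℕ (suc lo) (suc m) f                     ≡⟨ cong (f lo *_) (prodRangeℕ-snoc (suc lo) m f) ⟩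
    f lo * (prodRangeℕ (suc lo) m f * f (suc lo + m))        ≡⟨ *-assoc (f lo) _ _ ⟨
    f lo * prodRangeℕ (suc lo) m f * f (suc lo + m)          ≡⟨ cong (λ v → f lo * prodRangeℕ (suc lo) m f * f v) (+-suc lo m) ⟨
    f lo * prodRangeℕ (suc lo) m f * f (lo + suc m)          ∎

  prodRangeℕ-cong : ∀ lo m {f g} → (∀ i → lo ≤ i → i < lo + m → f i ≡ g i) →
                    prodRangeℕ lo m f ≡ prodRangeℕ lo m g
  prodRangeℕ-cong lo zero    f≗g = refl
  prodRangeℕ-cong lo (suc m) f≗g = cong₂ _*_
    (f≗g lo ≤-refl (m<m+n lo (s≤s z≤n)))
    (prodRangeℕ-cong (suc lo) m (λ i lo<i i<lo+m → f≗g i (<⇒≤ lo<i) (subst (i <_) (sym (+-suc lo m)) i<lo+m)))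

  prodRangeℕ-nonZero : ∀ lo m f → (∀ i → NonZero (f i)) → NonZero (prodRangeℕ lo m f)
  prodRangeℕ-nonZero lo zero    f f≢0 = _
  prodRangeℕ-nonZero lo (suc m) f f≢0 =
    m*n≢0 (f lo) _ {{f≢0 lo}} {{prodRangeℕ-nonZero (suc lo) m f f≢0}}

  antidiagonalSum : (ℕ → ℕ → ℕ) → ℕ → ℕ
  antidiagonalSum g zero    = g 0 0
  antidiagonalSum g (suc m) = g 0 (suc m) + antidiagonalSum (λ a b → g (suc a) b) m

  antidiagonalSum-cong : ∀ {f g} m → (∀ a b → f a b ≡ g a b) → antidiagonalSum f m ≡ antidiagonalSum g m
  antidiagonalSum-cong zero    f≗g = f≗g 0 0
  antidiagonalSum-cong (suc m) f≗g = cong₂ _+_ (f≗g 0 (suc m)) (antidiagonalSum-cong m (λ a b → f≗g (suc a) b))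

  antidiagonalSum-+ : ∀ f g m → antidiagonalSum (λ a b → f a b + g a b) m ≡ antidiagonalSum f m + antidiagonalSum g m
  antidiagonalSum-+ f g zero    = refl
  antidiagonalSum-+ f g (suc m) = trans (cong (f 0 (suc m) + g 0 (suc m) +_) (antidiagonalSum-+ _ _ m))
    (solve 4 (λ a b c d → a :+ b :+ (c :+ d) := a :+ c :+ (b :+ d)) refl
       (f 0 (suc m)) (g 0 (suc m)) (antidiagonalSum (λ a b → f (suc a) b) m) (antidiagonalSum (λ a b → g (suc a) b) m))

  antidiagonalSum-0 : ∀ m → antidiagonalSum (λ _ _ → 0) m ≡ 0
  antidiagonalSum-0 zero    = refl
  antidiagonalSum-0 (suc m) = antidiagonalSum-0 m

open NatOperators

module Evaluation where

  open import Data.Nat as ℕ using (zero; suc; s≤s)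
  import Data.Nat.Properties as ℕ
  import Data.Nat.Coprimality as Coprime
  import Data.Integer as ℤ
  import Data.Integer.Properties as ℤₚ
  open import Data.Rational
    using (ℚ; mkℚ; 0ℚ; 1ℚ; _/_; 1/_; _÷_; NonZero; _+_; _*_; -_; _-_)
  import Data.Rational.Properties as ℚ
  open import Data.Rational.Solver using (module +-*-Solver)
  open +-*-Solver
  open import Data.List using (List; []; _∷_; map; length)
  open import Data.List.Relation.Unary.All using (All; []; _∷_)
  open import Data.Product using (Σ; _×_; _,_)
  open import Relation.Binary.PropositionalEquality
  open ≡-Reasoning

  toℚ : ℕ → ℚ
  toℚ m = ℤ.+ m / 1

  toℚ-suc : ∀ m → toℚ (suc m) ≡ 1ℚ + toℚ m
  toℚ-suc m = begin
    ℤ.+ suc m / 1                       ≡⟨ cong (λ i → (ℤ.+ 1 ℤ.+ i) / 1) (sym (ℤₚ.*-identityʳ (ℤ.+ m))) ⟩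
    1ℚ + mkℚ (ℤ.+ m) 0 coprime          ≡⟨ cong (1ℚ +_) (ℚ.normalize-coprime coprime) ⟨
    1ℚ + toℚ m                          ∎
    where coprime = Coprime.sym (Coprime.1-coprimeTo m)

  toℚ-+ : ∀ a b → toℚ (a ℕ.+ b) ≡ toℚ a + toℚ b
  toℚ-+ zero    b = sym (ℚ.+-identityˡ (toℚ b))
  toℚ-+ (suc a) b = begin
    toℚ (suc (a ℕ.+ b))      ≡⟨ toℚ-suc (a ℕ.+ b) ⟩
    1ℚ + toℚ (a ℕ.+ b)       ≡⟨ cong (1ℚ +_) (toℚ-+ a b) ⟩
    1ℚ + (toℚ a + toℚ b)     ≡⟨ ℚ.+-assoc 1ℚ (toℚ a) (toℚ b) ⟨
    (1ℚ + toℚ a) + toℚ b     ≡⟨ cong (_+ toℚ b) (toℚ-suc a) ⟨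
    toℚ (suc a) + toℚ b      ∎

  toℚ-* : ∀ a b → toℚ (a ℕ.* b) ≡ toℚ a * toℚ b
  toℚ-* zero    b = sym (ℚ.*-zeroˡ (toℚ b))
  toℚ-* (suc a) b = begin
    toℚ (b ℕ.+ a ℕ.* b)        ≡⟨ toℚ-+ b (a ℕ.* b) ⟩
    toℚ b + toℚ (a ℕ.* b)      ≡⟨ cong (toℚ b +_) (toℚ-* a b) ⟩
    toℚ b + toℚ a * toℚ b      ≡⟨ solve 2 (λ x y → y :+ x :* y := (con 1ℚ :+ x) :* y) refl (toℚ a) (toℚ b) ⟩
    (1ℚ + toℚ a) * toℚ b       ≡⟨ cong (_* toℚ b) (toℚ-suc a) ⟨
    toℚ (suc a) * toℚ b        ∎

  toℚ-∸ : ∀ {a b} → b ≤ a → toℚ a - toℚ b ≡ toℚ (a ℕ.∸ b)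
  toℚ-∸ {a} {b} b≤a = begin
    toℚ a - toℚ b                       ≡⟨ cong (λ v → toℚ v - toℚ b) (ℕ.m∸n+n≡m b≤a) ⟨
    toℚ (a ℕ.∸ b ℕ.+ b) - toℚ b         ≡⟨ cong (_- toℚ b) (toℚ-+ (a ℕ.∸ b) b) ⟩
    (toℚ (a ℕ.∸ b) + toℚ b) - toℚ b     ≡⟨ solve 2 (λ u v → (u :+ v) :- v := u) refl (toℚ (a ℕ.∸ b)) (toℚ b) ⟩
    toℚ (a ℕ.∸ b)                       ∎

  toℚ-nonZero : ∀ m → .{{ℕ.NonZero m}} → NonZero (toℚ m)
  toℚ-nonZero (suc m) = ℚ.pos⇒nonZero (toℚ (suc m)) {{ℚ.normalize-pos (suc m) 1}}

  *-cancelˡ-≡0 : ∀ d e → .{{_ : NonZero d}} → d * e ≡ 0ℚ → e ≡ 0ℚ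
  *-cancelˡ-≡0 d e de≡0 = begin
    e                ≡⟨ ℚ.*-identityˡ e ⟨
    1ℚ * e           ≡⟨ cong (_* e) (ℚ.*-inverseˡ d) ⟨
    (1/ d * d) * e   ≡⟨ ℚ.*-assoc (1/ d) d e ⟩
    1/ d * (d * e)   ≡⟨ cong (1/ d *_) de≡0 ⟩
    1/ d * 0ℚ        ≡⟨ ℚ.*-zeroʳ (1/ d) ⟩
    0ℚ               ∎

  ÷-cross : ∀ a d e f → .{{_ : ℕ.NonZero d}} → a ℕ.* e ≡ f ℕ.* d →
            (toℚ a ÷ toℚ d) {{toℚ-nonZero d}} * toℚ e ≡ toℚ f
  ÷-cross a d e f ae≡fd = begin
    toℚ a * d⁻¹ * toℚ e      ≡⟨ solve 3 (λ a i e → a :* i :* e := (a :* e) :* i) refl (toℚ a) d⁻¹ (toℚ e) ⟩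
    (toℚ a * toℚ e) * d⁻¹    ≡⟨ cong (_* d⁻¹) (trans (sym (toℚ-* a e)) (trans (cong toℚ ae≡fd) (toℚ-* f d))) ⟩
    (toℚ f * toℚ d) * d⁻¹    ≡⟨ ℚ.*-assoc (toℚ f) (toℚ d) d⁻¹ ⟩
    toℚ f * (toℚ d * d⁻¹)    ≡⟨ cong (toℚ f *_) (ℚ.*-inverseʳ (toℚ d) {{toℚ-nonZero d}}) ⟩
    toℚ f * 1ℚ               ≡⟨ ℚ.*-identityʳ (toℚ f) ⟩
    toℚ f                    ∎
    where d⁻¹ = (1/ toℚ d) {{toℚ-nonZero d}}

  eval : Poly → ℚ → ℚ
  eval []      y = 0ℚ
  eval (a ∷ p) y = a + y * eval p y

  eval-+P : ∀ p q y → eval (p +P q) y ≡ eval p y + eval q y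
  eval-+P []      q       y = sym (ℚ.+-identityˡ _)
  eval-+P (a ∷ p) []      y = sym (ℚ.+-identityʳ _)
  eval-+P (a ∷ p) (b ∷ q) y = begin
    (a + b) + y * eval (p +P q) y            ≡⟨ cong (λ v → (a + b) + y * v) (eval-+P p q y) ⟩
    (a + b) + y * (eval p y + eval q y)
      ≡⟨ solve 5 (λ a b y u v → (a :+ b) :+ y :* (u :+ v) := (a :+ y :* u) :+ (b :+ y :* v)) refl a b y (eval p y) (eval q y) ⟩
    (a + y * eval p y) + (b + y * eval q y)  ∎

  eval-map-* : ∀ c p y → eval (map (c *_) p) y ≡ c * eval p y
  eval-map-* c []      y = sym (ℚ.*-zeroʳ c)
  eval-map-* c (a ∷ p) y = begin
    c * a + y * eval (map (c *_) p) y    ≡⟨ cong (λ v → c * a + y * v) (eval-map-* c p y) ⟩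
    c * a + y * (c * eval p y)           ≡⟨ solve 4 (λ c a y u → c :* a :+ y :* (c :* u) := c :* (a :+ y :* u)) refl c a y (eval p y) ⟩
    c * (a + y * eval p y)               ∎

  eval-*P : ∀ p q y → eval (p *P q) y ≡ eval p y * eval q y
  eval-*P []      q y = sym (ℚ.*-zeroˡ (eval q y))
  eval-*P (a ∷ p) q y = begin
    eval (map (a *_) q +P (0ℚ ∷ (p *P q))) y               ≡⟨ eval-+P (map (a *_) q) (0ℚ ∷ (p *P q)) y ⟩
    eval (map (a *_) q) y + (0ℚ + y * eval (p *P q) y)     ≡⟨ cong₂ (λ u v → u + (0ℚ + y * v)) (eval-map-* a q y) (eval-*P p q y) ⟩
    a * eval q y + (0ℚ + y * (eval p y * eval q y))
      ≡⟨ solve 4 (λ a y u v → a :* v :+ (con 0ℚ :+ y :* (u :* v)) := (a :+ y :* u) :* v) refl a y (eval p y) (eval q y) ⟩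
    (a + y * eval p y) * eval q y                          ∎

  eval-negP : ∀ p y → eval (negP p) y ≡ - eval p y
  eval-negP []      y = refl
  eval-negP (a ∷ p) y = begin
    - a + y * eval (negP p) y   ≡⟨ cong (λ v → - a + y * v) (eval-negP p y) ⟩
    - a + y * - eval p y        ≡⟨ solve 3 (λ a y u → :- a :+ y :* (:- u) := :- (a :+ y :* u)) refl a y (eval p y) ⟩
    - (a + y * eval p y)        ∎

  eval-cst : ∀ m y → eval (cst m) y ≡ toℚ m
  eval-cst m y = trans (cong (toℚ m +_) (ℚ.*-zeroʳ y)) (ℚ.+-identityʳ (toℚ m))

  eval-lin : ∀ c a x → eval (lin c a) (toℚ x) ≡ toℚ (c ℕ.+ a ℕ.* x)
  eval-lin c a x = begin
    toℚ c + toℚ x * (toℚ a + toℚ x * 0ℚ)   ≡⟨ solve 3 (λ c a x → c :+ x :* (a :+ x :* con 0ℚ) := c :+ a :* x) refl (toℚ c) (toℚ a) (toℚ x) ⟩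
    toℚ c + toℚ a * toℚ x                  ≡⟨ cong (toℚ c +_) (toℚ-* a x) ⟨
    toℚ c + toℚ (a ℕ.* x)                  ≡⟨ toℚ-+ c (a ℕ.* x) ⟨
    toℚ (c ℕ.+ a ℕ.* x)                    ∎

  eval-prodRange : ∀ lo m (c : ℕ → ℕ) a x →
    eval (prodRange lo m (λ i → lin (c i) a)) (toℚ x) ≡ toℚ (prodRangeℕ lo m (λ i → c i ℕ.+ a ℕ.* x))
  eval-prodRange lo zero    c a x = eval-cst 1 (toℚ x)
  eval-prodRange lo (suc m) c a x = begin
    eval (lin (c lo) a *P rest) (toℚ x)                       ≡⟨ eval-*P (lin (c lo) a) rest (toℚ x) ⟩
    eval (lin (c lo) a) (toℚ x) * eval rest (toℚ x)           ≡⟨ cong₂ _*_ (eval-lin (c lo) a x) (eval-prodRange (suc lo) m c a x) ⟩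
    toℚ (c lo ℕ.+ a ℕ.* x) * toℚ (prodRangeℕ (suc lo) m c+ax)  ≡⟨ toℚ-* (c lo ℕ.+ a ℕ.* x) _ ⟨
    toℚ (prodRangeℕ lo (suc m) c+ax)                          ∎
    where
    rest = prodRange (suc lo) m (λ i → lin (c i) a)
    c+ax = λ i → c i ℕ.+ a ℕ.* x

  VanishesFrom : ℕ → Poly → Set
  VanishesFrom N p = ∀ x → N ≤ x → eval p (toℚ x) ≡ 0ℚ

  Vanishes : Poly → Set
  Vanishes p = ∀ y → eval p y ≡ 0ℚ

  allZero⇒vanishes : ∀ {p} → All (_≡ 0ℚ) p → Vanishes p
  allZero⇒vanishes []                 y = refl
  allZero⇒vanishes {_ ∷ p} (refl ∷ ps) y = begin
    0ℚ + y * eval p y   ≡⟨ cong (λ v → 0ℚ + y * v) (allZero⇒vanishes ps y) ⟩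
    0ℚ + y * 0ℚ         ≡⟨ solve 1 (λ y → con 0ℚ :+ y :* con 0ℚ := con 0ℚ) refl y ⟩
    0ℚ                  ∎

  -- Synthetic division by (z - r): the quotient is read off by Horner's scheme.
  quotient : ℚ → Poly → Poly
  quotient r []          = []
  quotient r (a ∷ [])    = []
  quotient r (a ∷ b ∷ q) = eval (b ∷ q) r ∷ quotient r (b ∷ q)

  length-quotient : ∀ r a q → length (quotient r (a ∷ q)) ≡ length q
  length-quotient r a []      = refl
  length-quotient r a (b ∷ q) = cong suc (length-quotient r b q)

  eval-quotient : ∀ r p y → eval p y ≡ (y - r) * eval (quotient r p) y + eval p r
  eval-quotient r []          y = solve 2 (λ y r → con 0ℚ := (y :- r) :* con 0ℚ :+ con 0ℚ) refl y r
  eval-quotient r (a ∷ [])    y = solve 3 (λ a y r → a :+ y :* con 0ℚ := (y :- r) :* con 0ℚ :+ (a :+ r :* con 0ℚ)) refl a y r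
  eval-quotient r (a ∷ b ∷ q) y = begin
    a + y * eval (b ∷ q) y                 ≡⟨ cong (λ v → a + y * v) (eval-quotient r (b ∷ q) y) ⟩
    a + y * ((y - r) * s + qr)
      ≡⟨ solve 5 (λ a y r s qr → a :+ y :* ((y :- r) :* s :+ qr) := (y :- r) :* (qr :+ y :* s) :+ (a :+ r :* qr)) refl a y r s qr ⟩
    (y - r) * (qr + y * s) + (a + r * qr)  ∎
    where
    s  = eval (quotient r (b ∷ q)) y
    qr = eval (b ∷ q) r

  quotient-vanishesFrom : ∀ N p → VanishesFrom N p → VanishesFrom (suc N) (quotient (toℚ N) p)
  quotient-vanishesFrom N p p-van x N<x = *-cancelˡ-≡0 (toℚ (suc d)) s {{toℚ-nonZero (suc d)}} (begin
    toℚ (suc d) * s                      ≡⟨ cong (_* s) x-N≡1+d ⟨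
    (toℚ x - toℚ N) * s                  ≡⟨ ℚ.+-identityʳ _ ⟨
    (toℚ x - toℚ N) * s + 0ℚ             ≡⟨ cong ((toℚ x - toℚ N) * s +_) (p-van N ℕ.≤-refl) ⟨
    (toℚ x - toℚ N) * s + eval p (toℚ N) ≡⟨ eval-quotient (toℚ N) p (toℚ x) ⟨
    eval p (toℚ x)                       ≡⟨ p-van x (ℕ.<⇒≤ N<x) ⟩
    0ℚ                                   ∎)
    where
    s = eval (quotient (toℚ N) p) (toℚ x)
    d = x ℕ.∸ suc N
    x-N≡1+d : toℚ x - toℚ N ≡ toℚ (suc d)
    x-N≡1+d = trans (toℚ-∸ (ℕ.<⇒≤ N<x)) (cong toℚ (ℕ.+-∸-assoc 1 N<x))

  ∷-vanishes⇒head≡0 : ∀ a q → Vanishes (a ∷ q) → a ≡ 0ℚ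
  ∷-vanishes⇒head≡0 a q vanishes = begin
    a                       ≡⟨ ℚ.+-identityʳ a ⟨
    a + 0ℚ                  ≡⟨ cong (a +_) (ℚ.*-zeroˡ (eval q 0ℚ)) ⟨
    a + 0ℚ * eval q 0ℚ      ≡⟨ vanishes 0ℚ ⟩
    0ℚ                      ∎

  ∷-vanishes⇒tail-vanishesFrom1 : ∀ a q → Vanishes (a ∷ q) → VanishesFrom 1 q
  ∷-vanishes⇒tail-vanishesFrom1 a q vanishes (suc x) _ =
    *-cancelˡ-≡0 (toℚ (suc x)) (eval q (toℚ (suc x))) {{toℚ-nonZero (suc x)}} (begin
      toℚ (suc x) * eval q (toℚ (suc x))        ≡⟨ ℚ.+-identityˡ _ ⟨
      0ℚ + toℚ (suc x) * eval q (toℚ (suc x))   ≡⟨ cong (λ b → b + toℚ (suc x) * eval q (toℚ (suc x))) (∷-vanishes⇒head≡0 a q vanishes) ⟨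
      eval (a ∷ q) (toℚ (suc x))                ≡⟨ vanishes (toℚ (suc x)) ⟩
      0ℚ                                        ∎)

  -- The bound m on the length lets the recursion descend to the (shorter) quotient.
  vanishesFrom⇒allZero : ∀ m p → length p ≤ m → ∀ N → VanishesFrom N p → All (_≡ 0ℚ) p
  vanishesFrom⇒allZero m       []      _       N _     = []
  vanishesFrom⇒allZero (suc m) (a ∷ q) (s≤s l) N p-van =
    ∷-vanishes⇒head≡0 a q vanishes ∷ vanishesFrom⇒allZero m q l 1 (∷-vanishes⇒tail-vanishesFrom1 a q vanishes)
    where
    r = toℚ N
    quotient-allZero : All (_≡ 0ℚ) (quotient r (a ∷ q))
    quotient-allZero = vanishesFrom⇒allZero m (quotient r (a ∷ q))
      (subst (ℕ._≤ m) (sym (length-quotient r a q)) l) (suc N) (quotient-vanishesFrom N (a ∷ q) p-van)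
    vanishes : Vanishes (a ∷ q)
    vanishes y = begin
      eval (a ∷ q) y                                      ≡⟨ eval-quotient r (a ∷ q) y ⟩
      (y - r) * eval (quotient r (a ∷ q)) y + eval (a ∷ q) r
        ≡⟨ cong₂ (λ u v → (y - r) * u + v) (allZero⇒vanishes quotient-allZero y) (p-van N ℕ.≤-refl) ⟩
      (y - r) * 0ℚ + 0ℚ                                   ≡⟨ solve 2 (λ y r → (y :- r) :* con 0ℚ :+ con 0ℚ := con 0ℚ) refl y r ⟩
      0ℚ                                                  ∎

  -- The denominator must evaluate to a positive integer, so that V is determined.
  record ValueAt (r : RatFun) (x : ℕ) (V : ℚ) : Set where
    constructor valueAt
    field
      den-1 : ℕ
      den≡  : eval (den r) (toℚ x) ≡ toℚ (suc den-1)
      num≡  : eval (num r) (toℚ x) ≡ V * toℚ (suc den-1)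

  valueAt-⁄ : ∀ {r x V} d → .{{_ : ℕ.NonZero d}} →
              eval (den r) (toℚ x) ≡ toℚ d → eval (num r) (toℚ x) ≡ V * toℚ d → ValueAt r x V
  valueAt-⁄ (suc d) den≡d num≡Vd = valueAt d den≡d num≡Vd

  valueAt-0R : ∀ x → ValueAt 0R x 0ℚ
  valueAt-0R x = valueAt 0 (eval-cst 1 (toℚ x)) (trans (eval-cst 0 (toℚ x)) (sym (ℚ.*-zeroˡ 1ℚ)))

  valueAt-1R : ∀ x → ValueAt 1R x 1ℚ
  valueAt-1R x = valueAt 0 (eval-cst 1 (toℚ x)) (trans (eval-cst 1 (toℚ x)) (sym (ℚ.*-identityˡ 1ℚ)))

  eval-*P-toℚ : ∀ p q y {m n} → eval p y ≡ toℚ m → eval q y ≡ toℚ n → eval (p *P q) y ≡ toℚ (m ℕ.* n)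
  eval-*P-toℚ p q y {m} {n} p≡m q≡n = begin
    eval (p *P q) y          ≡⟨ eval-*P p q y ⟩
    eval p y * eval q y      ≡⟨ cong₂ _*_ p≡m q≡n ⟩
    toℚ m * toℚ n            ≡⟨ toℚ-* m n ⟨
    toℚ (m ℕ.* n)            ∎

  valueAt-*R : ∀ {r s x V W} → ValueAt r x V → ValueAt s x W → ValueAt (r *R s) x (V * W)
  valueAt-*R {a ⁄ b} {c ⁄ d} {x} {V} {W} (valueAt m b≡m a≡Vm) (valueAt n d≡n c≡Wn) =
    valueAt (n ℕ.+ m ℕ.* suc n) (eval-*P-toℚ b d X {suc m} {suc n} b≡m d≡n) (begin
      eval (a *P c) X                                    ≡⟨ eval-*P a c X ⟩
      eval a X * eval c X                                ≡⟨ cong₂ _*_ a≡Vm c≡Wn ⟩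
      (V * toℚ (suc m)) * (W * toℚ (suc n))
        ≡⟨ solve 4 (λ V W m n → (V :* m) :* (W :* n) := (V :* W) :* (m :* n)) refl V W (toℚ (suc m)) (toℚ (suc n)) ⟩
      (V * W) * (toℚ (suc m) * toℚ (suc n))              ≡⟨ cong ((V * W) *_) (toℚ-* (suc m) (suc n)) ⟨
      (V * W) * toℚ (suc m ℕ.* suc n)                    ∎)
    where X = toℚ x

  valueAt-+R : ∀ {r s x V W} → ValueAt r x V → ValueAt s x W → ValueAt (r +R s) x (V + W)
  valueAt-+R {a ⁄ b} {c ⁄ d} {x} {V} {W} (valueAt m b≡m a≡Vm) (valueAt n d≡n c≡Wn) =
    valueAt (n ℕ.+ m ℕ.* suc n) (eval-*P-toℚ b d X {suc m} {suc n} b≡m d≡n) (begin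
      eval ((a *P d) +P (c *P b)) X                            ≡⟨ eval-+P (a *P d) (c *P b) X ⟩
      eval (a *P d) X + eval (c *P b) X                        ≡⟨ cong₂ _+_ (eval-*P a d X) (eval-*P c b X) ⟩
      eval a X * eval d X + eval c X * eval b X                ≡⟨ cong₂ _+_ (cong₂ _*_ a≡Vm d≡n) (cong₂ _*_ c≡Wn b≡m) ⟩
      (V * toℚ (suc m)) * toℚ (suc n) + (W * toℚ (suc n)) * toℚ (suc m)
        ≡⟨ solve 4 (λ V W m n → (V :* m) :* n :+ (W :* n) :* m := (V :+ W) :* (m :* n)) refl V W (toℚ (suc m)) (toℚ (suc n)) ⟩
      (V + W) * (toℚ (suc m) * toℚ (suc n))                    ≡⟨ cong ((V + W) *_) (toℚ-* (suc m) (suc n)) ⟨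
      (V + W) * toℚ (suc m ℕ.* suc n)                          ∎)
    where X = toℚ x

  ≈R-fromValues : ∀ r s → (∀ x → 1 ≤ x → Σ ℚ λ V → ValueAt r x V × ValueAt s x V) → r ≈R s
  ≈R-fromValues (a ⁄ b) (c ⁄ d) values =
    vanishesFrom⇒allZero _ ((a *P d) +P negP (c *P b)) ℕ.≤-refl 1 vanishes
    where
    vanishes : VanishesFrom 1 ((a *P d) +P negP (c *P b))
    vanishes x 1≤x with values x 1≤x
    ... | V , valueAt m b≡m a≡Vm , valueAt n d≡n c≡Vn = begin
      eval ((a *P d) +P negP (c *P b)) X                   ≡⟨ eval-+P (a *P d) (negP (c *P b)) X ⟩
      eval (a *P d) X + eval (negP (c *P b)) X             ≡⟨ cong (eval (a *P d) X +_) (eval-negP (c *P b) X) ⟩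
      eval (a *P d) X - eval (c *P b) X                    ≡⟨ cong₂ _-_ (eval-*P a d X) (eval-*P c b X) ⟩
      eval a X * eval d X - eval c X * eval b X            ≡⟨ cong₂ _-_ (cong₂ _*_ a≡Vm d≡n) (cong₂ _*_ c≡Vn b≡m) ⟩
      (V * toℚ (suc m)) * toℚ (suc n) - (V * toℚ (suc n)) * toℚ (suc m)
        ≡⟨ solve 3 (λ V m n → (V :* m) :* n :- (V :* n) :* m := con 0ℚ) refl V (toℚ (suc m)) (toℚ (suc n)) ⟩
      0ℚ                                                   ∎
      where X = toℚ x

module Lists where

  open import Data.Nat as ℕ using (zero; suc; _+_; pred)
  open import Data.Nat.Properties using (suc-injective)
  open import Data.Rational using (ℚ; 0ℚ) renaming (_+_ to _+ℚ_; _*_ to _*ℚ_)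
  import Data.Rational.Properties as ℚ
  open import Data.List using (List; []; _∷_; map; _++_; cartesianProductWith)
  open import Data.List.Membership.Propositional.Properties using (∈-++⁺ˡ; ∈-++⁺ʳ; ∈-++⁻)
  open import Data.List.Relation.Unary.Any using (here; there)
  open import Data.List.Relation.Unary.Unique.Propositional.Properties using (++⁺)
  open import Data.List.Relation.Binary.Permutation.Propositional as ↭ using (_↭_)
  open import Data.Product using (∃₂; _×_; _,_)
  open import Data.Sum using (inj₁; inj₂)
  open import Data.Empty using (⊥)
  open import Function using (_∘_)
  open import Function.Bundles using (mk⇔; Equivalence)
  open import Data.List.Membership.Propositional.Properties.WithK using (unique∧set⇒bag)
  open import Data.List.Relation.Binary.BagAndSetEquality using (∼bag⇒↭)
  open import Relation.Binary.PropositionalEquality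
  open ≡-Reasoning
  open Evaluation using (toℚ; toℚ-+; toℚ-*)

  Enumerates : {A : Set} → List A → (A → Set) → Set
  Enumerates xs P = Unique xs × (∀ t → (t ∈ xs) ⇔ P t)

  concatAntidiagonal : {X : Set} → (ℕ → ℕ → List X) → ℕ → List X
  concatAntidiagonal g zero    = g 0 0
  concatAntidiagonal g (suc m) = g 0 (suc m) ++ concatAntidiagonal (λ a b → g (suc a) b) m

  ∈-concatAntidiagonal⁻ : ∀ {X : Set} (g : ℕ → ℕ → List X) m {z} → z ∈ concatAntidiagonal g m →
                          ∃₂ λ a b → a + b ≡ m × z ∈ g a b
  ∈-concatAntidiagonal⁻ g zero    z∈ = 0 , 0 , refl , z∈
  ∈-concatAntidiagonal⁻ g (suc m) z∈ with ∈-++⁻ (g 0 (suc m)) z∈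
  ... | inj₁ z∈g = 0 , suc m , refl , z∈g
  ... | inj₂ z∈rest with ∈-concatAntidiagonal⁻ (λ a b → g (suc a) b) m z∈rest
  ...   | a , b , a+b≡m , z∈g = suc a , b , cong suc a+b≡m , z∈g

  ∈-concatAntidiagonal⁺ : ∀ {X : Set} (g : ℕ → ℕ → List X) {a b m z} → a + b ≡ m → z ∈ g a b →
                          z ∈ concatAntidiagonal g m
  ∈-concatAntidiagonal⁺ g {zero}  {zero}  refl z∈ = z∈
  ∈-concatAntidiagonal⁺ g {zero}  {suc b} refl z∈ = ∈-++⁺ˡ z∈
  ∈-concatAntidiagonal⁺ g {suc a} {b} {suc m} a+b≡m z∈ =
    ∈-++⁺ʳ (g 0 (suc m)) (∈-concatAntidiagonal⁺ (λ a b → g (suc a) b) (suc-injective a+b≡m) z∈)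

  -- The blocks are disjoint because tag recovers a from any element of g a b.
  concatAntidiagonal-unique : ∀ {X : Set} (g : ℕ → ℕ → List X) m (tag : X → ℕ) →
    (∀ {a b z} → a + b ≡ m → z ∈ g a b → tag z ≡ a) → (∀ {a b} → a + b ≡ m → Unique (g a b)) →
    Unique (concatAntidiagonal g m)
  concatAntidiagonal-unique g zero    tag tagged unique = unique refl
  concatAntidiagonal-unique g (suc m) tag tagged unique = ++⁺ (unique refl)
    (concatAntidiagonal-unique (λ a b → g (suc a) b) m (pred ∘ tag)
       (λ a+b≡m z∈ → cong pred (tagged (cong suc a+b≡m) z∈)) (λ a+b≡m → unique (cong suc a+b≡m)))
    disjoint
    where
    disjoint : ∀ {z} → z ∈ g 0 (suc m) × z ∈ concatAntidiagonal (λ a b → g (suc a) b) m → ⊥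
    disjoint (z∈g₀ , z∈rest) with ∈-concatAntidiagonal⁻ (λ a b → g (suc a) b) m z∈rest
    ... | a , b , a+b≡m , z∈g with trans (sym (tagged refl z∈g₀)) (tagged (cong suc a+b≡m) z∈g)
    ...   | ()

  enumerations-↭ : ∀ {A : Set} {P : A → Set} {xs ys} → Enumerates xs P → Enumerates ys P → xs ↭ ys
  enumerations-↭ (xs-unique , ∈xs⇔P) (ys-unique , ∈ys⇔P) = ∼bag⇒↭ (unique∧set⇒bag xs-unique ys-unique
    (λ {t} → mk⇔ (Equivalence.from (∈ys⇔P t) ∘ Equivalence.to (∈xs⇔P t))
                 (Equivalence.from (∈xs⇔P t) ∘ Equivalence.to (∈ys⇔P t))))

  sumBy : {A : Set} → (A → ℚ) → List A → ℚ
  sumBy f []       = 0ℚ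
  sumBy f (a ∷ xs) = f a +ℚ sumBy f xs

  module _ {A : Set} where

    sumBy-++ : ∀ (f : A → ℚ) xs ys → sumBy f (xs ++ ys) ≡ sumBy f xs +ℚ sumBy f ys
    sumBy-++ f []       ys = sym (ℚ.+-identityˡ _)
    sumBy-++ f (a ∷ xs) ys = trans (cong (f a +ℚ_) (sumBy-++ f xs ys)) (sym (ℚ.+-assoc (f a) _ _))

    sumBy-map : ∀ {B : Set} (f : B → ℚ) (g : A → B) xs → sumBy f (map g xs) ≡ sumBy (f ∘ g) xs
    sumBy-map f g []       = refl
    sumBy-map f g (a ∷ xs) = cong (f (g a) +ℚ_) (sumBy-map f g xs)

    sumBy-cong : ∀ {f g : A → ℚ} xs → (∀ {a} → a ∈ xs → f a ≡ g a) → sumBy f xs ≡ sumBy g xs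
    sumBy-cong []       f≗g = refl
    sumBy-cong (a ∷ xs) f≗g = cong₂ _+ℚ_ (f≗g (here refl)) (sumBy-cong xs (f≗g ∘ there))

    sumBy-*ˡ : ∀ c (f : A → ℚ) xs → sumBy (λ a → c *ℚ f a) xs ≡ c *ℚ sumBy f xs
    sumBy-*ˡ c f []       = sym (ℚ.*-zeroʳ c)
    sumBy-*ˡ c f (a ∷ xs) = trans (cong (c *ℚ f a +ℚ_) (sumBy-*ˡ c f xs)) (sym (ℚ.*-distribˡ-+ c (f a) _))

    sumBy-↭ : ∀ (f : A → ℚ) {xs ys} → xs ↭ ys → sumBy f xs ≡ sumBy f ys
    sumBy-↭ f ↭.refl         = refl
    sumBy-↭ f (↭.prep a p)   = cong (f a +ℚ_) (sumBy-↭ f p)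
    sumBy-↭ f (↭.swap {xs} {ys} a b p) = begin
      f a +ℚ (f b +ℚ sumBy f xs)  ≡⟨ ℚ.+-assoc (f a) (f b) _ ⟨
      (f a +ℚ f b) +ℚ sumBy f xs  ≡⟨ cong₂ _+ℚ_ (ℚ.+-comm (f a) (f b)) (sumBy-↭ f p) ⟩
      (f b +ℚ f a) +ℚ sumBy f ys  ≡⟨ ℚ.+-assoc (f b) (f a) _ ⟩
      f b +ℚ (f a +ℚ sumBy f ys)  ∎
    sumBy-↭ f (↭.trans p q)  = trans (sumBy-↭ f p) (sumBy-↭ f q)

  sumBy-cartesianProductWith : ∀ {A B C : Set} (_∙_ : A → B → C) (f : A → ℚ) (g : B → ℚ) (h : C → ℚ) →
    (∀ a b → h (a ∙ b) ≡ f a *ℚ g b) →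
    ∀ xs ys → sumBy h (cartesianProductWith _∙_ xs ys) ≡ sumBy f xs *ℚ sumBy g ys
  sumBy-cartesianProductWith _∙_ f g h h≡f*g []       ys = sym (ℚ.*-zeroˡ (sumBy g ys))
  sumBy-cartesianProductWith _∙_ f g h h≡f*g (a ∷ xs) ys = begin
    sumBy h (map∙ ++ cartesianProductWith _∙_ xs ys)               ≡⟨ sumBy-++ h map∙ _ ⟩
    sumBy h map∙ +ℚ sumBy h (cartesianProductWith _∙_ xs ys)       ≡⟨ cong₂ _+ℚ_ row (sumBy-cartesianProductWith _∙_ f g h h≡f*g xs ys) ⟩
    f a *ℚ sumBy g ys +ℚ sumBy f xs *ℚ sumBy g ys                  ≡⟨ ℚ.*-distribʳ-+ (sumBy g ys) (f a) _ ⟨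
    (f a +ℚ sumBy f xs) *ℚ sumBy g ys                              ∎
    where
    map∙ = map (a ∙_) ys
    row : sumBy h map∙ ≡ f a *ℚ sumBy g ys
    row = begin
      sumBy h map∙                     ≡⟨ sumBy-map h (a ∙_) ys ⟩
      sumBy (h ∘ (a ∙_)) ys            ≡⟨ sumBy-cong ys (λ {b} _ → h≡f*g a b) ⟩
      sumBy (λ b → f a *ℚ g b) ys      ≡⟨ sumBy-*ˡ (f a) g ys ⟩
      f a *ℚ sumBy g ys                ∎

  sumBy-concatAntidiagonal : ∀ {A : Set} (f : A → ℚ) (g : ℕ → ℕ → List A) (c : ℕ → ℕ → ℕ) m →
    (∀ {a b} → a + b ≡ m → sumBy f (g a b) ≡ toℚ (c a b)) →
    sumBy f (concatAntidiagonal g m) ≡ toℚ (antidiagonalSum c m)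
  sumBy-concatAntidiagonal f g c zero    sums = sums refl
  sumBy-concatAntidiagonal f g c (suc m) sums = begin
    sumBy f (g 0 (suc m) ++ concatAntidiagonal (λ a b → g (suc a) b) m)
      ≡⟨ sumBy-++ f (g 0 (suc m)) _ ⟩
    sumBy f (g 0 (suc m)) +ℚ sumBy f (concatAntidiagonal (λ a b → g (suc a) b) m)
      ≡⟨ cong₂ _+ℚ_ (sums refl) (sumBy-concatAntidiagonal f _ (λ a b → c (suc a) b) m (sums ∘ cong suc)) ⟩
    toℚ (c 0 (suc m)) +ℚ toℚ (antidiagonalSum (λ a b → c (suc a) b) m)
      ≡⟨ toℚ-+ (c 0 (suc m)) _ ⟨
    toℚ (antidiagonalSum c (suc m))  ∎

module ForestNumbers (k-1 : ℕ) where

  open import Data.Nat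
  open import Data.Nat.Properties
  open import Relation.Binary.PropositionalEquality
  open import Data.Nat.Solver using (module +-*-Solver)
  open +-*-Solver
  open ≡-Reasoning

  k : ℕ
  k = suc k-1

  -- The number of k-ary forests of y trees with n vertices: either the first tree is empty,
  -- or deleting its root leaves a forest of y - 1 + k trees.
  forestCount : ℕ → ℕ → ℕ
  forestCount zero    y       = 1
  forestCount (suc n) zero    = 0
  forestCount (suc n) (suc y) = forestCount (suc n) y + forestCount n (y + k)

  forestCount-1 : ∀ y → forestCount 1 y ≡ y
  forestCount-1 zero    = refl
  forestCount-1 (suc y) = trans (+-comm (forestCount 1 y) 1) (cong suc (forestCount-1 y))

  closedProduct : ℕ → ℕ → ℕ
  closedProduct n y = prodRangeℕ 1 (n ∸ 1) (λ i → k * n ∸ i + y)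

  forestCount-closedForm : ∀ m y → forestCount (suc m) y * suc m ! ≡ y * closedProduct (suc m) y
  forestCount-closedForm m       zero    = refl
  forestCount-closedForm zero    (suc y) = begin
    (forestCount 1 y + 1) * 1   ≡⟨ cong (λ v → (v + 1) * 1) (forestCount-1 y) ⟩
    (y + 1) * 1                 ≡⟨ cong (_* 1) (+-comm y 1) ⟩
    suc y * 1                   ∎
  forestCount-closedForm (suc p) (suc y) = begin
    (forestCount n y + forestCount (suc p) (y + k)) * (n * F)
      ≡⟨ solve 4 (λ a b n F → (a :+ b) :* (n :* F) := a :* (n :* F) :+ n :* (b :* F)) refl (forestCount n y) (forestCount (suc p) (y + k)) n F ⟩
    forestCount n y * (n * F) + n * (forestCount (suc p) (y + k) * F)
      ≡⟨ cong₂ (λ u v → u + n * v) (forestCount-closedForm (suc p) y) (forestCount-closedForm p (y + k)) ⟩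
    y * closedProduct n y + n * ((y + k) * closedProduct (suc p) (y + k))
      ≡⟨ cong₂ (λ u v → y * u + n * ((y + k) * v)) last-factor shifted-product ⟩
    y * (R * (K ∸ suc p + y)) + n * ((y + k) * R)
      ≡⟨ cong (λ v → y * (R * (v + y)) + n * ((y + k) * R)) K∸[1+p] ⟩
    y * (R * (suc (k-1 * n) + y)) + n * ((y + k) * R)
      ≡⟨ solve 4 (λ y R p k' → y :* (R :* ((con 1 :+ k' :* (con 2 :+ p)) :+ y)) :+ (con 2 :+ p) :* ((y :+ (con 1 :+ k')) :* R)
                             := (con 1 :+ y) :* (((con 1 :+ p :+ k' :* (con 2 :+ p)) :+ (con 1 :+ y)) :* R)) refl y R p k-1 ⟩
    suc y * ((suc (p + k-1 * n) + suc y) * R)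
      ≡⟨ cong (suc y *_) first-factor ⟨
    suc y * closedProduct n (suc y)   ∎
    where
    n = suc (suc p)
    K = k * n
    F = suc p !
    R = prodRangeℕ 1 p (λ i → K ∸ i + y)
    K∸[1+p] : K ∸ suc p ≡ suc (k-1 * n)
    K∸[1+p] = trans (cong (_∸ suc p) (sym (+-suc (suc p) (k-1 * n)))) (m+n∸m≡n (suc p) (suc (k-1 * n)))
    first-factor : closedProduct n (suc y) ≡ (suc (p + k-1 * n) + suc y) * R
    first-factor = cong ((suc (p + k-1 * n) + suc y) *_) (trans (prodRangeℕ-shift 1 p (λ i → K ∸ i + suc y))
      (prodRangeℕ-cong 1 p (λ i _ i<1+p → begin
        K ∸ suc i + suc y    ≡⟨ +-suc (K ∸ suc i) y ⟩
        suc (K ∸ suc i) + y  ≡⟨ cong (_+ y) (+-∸-assoc 1 (≤-trans i<1+p (≤-trans (n≤1+n (suc p)) (m≤m+n n (k-1 * n))))) ⟨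
        K ∸ i + y            ∎)))
    last-factor : closedProduct n y ≡ R * (K ∸ suc p + y)
    last-factor = prodRangeℕ-snoc 1 p (λ i → K ∸ i + y)
    shifted-product : closedProduct (suc p) (y + k) ≡ R
    shifted-product = prodRangeℕ-cong 1 p λ i _ i<1+p → begin
      k * suc p ∸ i + (y + k)      ≡⟨ solve 3 (λ a y k → a :+ (y :+ k) := (a :+ k) :+ y) refl (k * suc p ∸ i) y k ⟩
      (k * suc p ∸ i + k) + y      ≡⟨ cong (_+ y) (+-∸-comm k (≤-trans (<⇒≤ i<1+p) (m≤m+n (suc p) (k-1 * suc p)))) ⟨
      (k * suc p + k) ∸ i + y      ≡⟨ cong (λ v → v ∸ i + y) (trans (+-comm (k * suc p) k) (sym (*-suc k (suc p)))) ⟩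
      K ∸ i + y                    ∎

  hookNumerator hookDenominator : ℕ → ℕ → ℕ
  hookNumerator   m x = prodRangeℕ 1 (suc m) (λ i → k * suc (suc m) ∸ i + 1 * x)
  hookDenominator m x = k * suc (suc m) * prodRangeℕ 1 m (λ i → k * suc (suc m) ∸ k ∸ i + k * x)

  hookDenominator-nonZero : ∀ m x → NonZero (hookDenominator m (suc x))
  hookDenominator-nonZero m x = m*n≢0 (k * suc (suc m)) _ {{m*n≢0 k (suc (suc m))}}
    {{prodRangeℕ-nonZero 1 m (λ i → k * suc (suc m) ∸ k ∸ i + k * suc x) (λ i → ≢-nonZero (m+1+n≢0 _))}}

  -- Both sides times (m + 1)! are x · k · ∏_{i=1}^{m+1}(k(m+2) - i + x) · ∏_{i=1}^{m}(k(m+1) - i + kx),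
  -- by the closed form of forestCount applied twice.
  hook-step : ∀ m x → hookNumerator m x * forestCount (suc m) (k * x) ≡ forestCount (suc (suc m)) x * hookDenominator m x
  hook-step m x = *-cancelʳ-≡ _ _ F {{suc m !≢0}} (begin
    N * forestCount (suc m) (k * x) * F          ≡⟨ *-assoc N _ F ⟩
    N * (forestCount (suc m) (k * x) * F)        ≡⟨ cong (N *_) (forestCount-closedForm m (k * x)) ⟩
    N * (k * x * closedProduct (suc m) (k * x))  ≡⟨ cong (λ v → N * (k * x * v)) Q≡closedProduct ⟨
    N * (k * x * Q)                              ≡⟨ solve 4 (λ N k x Q → N :* (k :* x :* Q) := x :* N :* (k :* Q)) refl N k x Q ⟩
    x * N * (k * Q)                              ≡⟨ cong (λ v → x * v * (k * Q)) N≡closedProduct ⟩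
    x * closedProduct h x * (k * Q)              ≡⟨ cong (_* (k * Q)) (forestCount-closedForm (suc m) x) ⟨
    forestCount h x * (h * F) * (k * Q)
      ≡⟨ solve 5 (λ a h F k Q → a :* (h :* F) :* (k :* Q) := a :* (k :* h :* Q) :* F) refl (forestCount h x) h F k Q ⟩
    forestCount h x * (k * h * Q) * F            ∎)
    where
    h = suc (suc m)
    F = suc m !
    N = hookNumerator m x
    Q = prodRangeℕ 1 m (λ i → k * h ∸ k ∸ i + k * x)
    N≡closedProduct : N ≡ closedProduct h x
    N≡closedProduct = prodRangeℕ-cong 1 (suc m) (λ i _ _ → cong (k * h ∸ i +_) (*-identityˡ x))
    Q≡closedProduct : Q ≡ closedProduct (suc m) (k * x)
    Q≡closedProduct = prodRangeℕ-cong 1 m (λ i _ _ → cong (λ v → v ∸ i + k * x)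
      (trans (cong (_∸ k) (*-suc k (suc m))) (m+n∸m≡n k (k * suc m))))

  forestCount-convolution : ∀ m x y → antidiagonalSum (λ a b → forestCount a x * forestCount b y) m ≡ forestCount m (x + y)
  forestCount-convolution zero    x       y = refl
  forestCount-convolution (suc m) zero    y = begin
    forestCount (suc m) y + 0 + antidiagonalSum (λ _ _ → 0) m   ≡⟨ cong (forestCount (suc m) y + 0 +_) (antidiagonalSum-0 m) ⟩
    forestCount (suc m) y + 0 + 0                              ≡⟨ trans (+-identityʳ _) (+-identityʳ _) ⟩
    forestCount (suc m) y                                      ∎
  forestCount-convolution (suc m) (suc x) y = begin
    forestCount (suc m) y + 0 + S (λ a b → (forestCount (suc a) x + forestCount a (x + k)) * forestCount b y)
      ≡⟨ cong (forestCount (suc m) y + 0 +_) (trans (antidiagonalSum-cong m (λ a b → *-distribʳ-+ (forestCount b y) (forestCount (suc a) x) _)) (antidiagonalSum-+ _ _ m)) ⟩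
    forestCount (suc m) y + 0 + (S (λ a b → forestCount (suc a) x * forestCount b y) + S (λ a b → forestCount a (x + k) * forestCount b y))
      ≡⟨ +-assoc (forestCount (suc m) y + 0) _ _ ⟨
    (forestCount (suc m) y + 0 + S (λ a b → forestCount (suc a) x * forestCount b y)) + S (λ a b → forestCount a (x + k) * forestCount b y)
      ≡⟨ cong₂ _+_ (forestCount-convolution (suc m) x y) (forestCount-convolution m (x + k) y) ⟩
    forestCount (suc m) (x + y) + forestCount m (x + k + y)
      ≡⟨ cong (λ v → forestCount (suc m) (x + y) + forestCount m v) (solve 3 (λ x k y → x :+ k :+ y := x :+ y :+ k) refl x k y) ⟩
    forestCount (suc m) (x + y) + forestCount m (x + y + k)   ∎
    where
    S : (ℕ → ℕ → ℕ) → ℕ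
    S g = antidiagonalSum g m

module TreeEnumeration (k : ℕ) where

  open Lists using (Enumerates; concatAntidiagonal; ∈-concatAntidiagonal⁻; ∈-concatAntidiagonal⁺; concatAntidiagonal-unique)

  open import Data.Nat
  open import Data.Nat.Properties
  open import Data.List using (List; []; _∷_; map; cartesianProductWith)
  open import Data.List.Membership.Propositional.Properties
    using (∈-map⁺; ∈-map⁻; ∈-cartesianProductWith⁺; ∈-cartesianProductWith⁻)
  open import Data.List.Relation.Unary.Any using (here)
  open import Data.List.Relation.Unary.AllPairs using ([]; _∷_)
  open import Data.List.Relation.Unary.Unique.Propositional.Properties using (map⁺; cartesianProductWith⁺)
  import Data.List.Relation.Unary.All as All
  open import Data.Vec using (Vec; []; _∷_)
  open import Data.Vec.Properties using (∷-injective)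
  open import Data.Product using (_,_; proj₁; proj₂)
  open import Function.Bundles using (mk⇔; Equivalence)
  open import Relation.Binary.PropositionalEquality

  forestsWith : (ℕ → List (KTree k)) → (j : ℕ) → ℕ → List (Vec (KTree k) j)
  forestsWith trees zero    zero    = [] ∷ []
  forestsWith trees zero    (suc m) = []
  forestsWith trees (suc j) m       =
    concatAntidiagonal (λ a b → cartesianProductWith _∷_ (trees a) (forestsWith trees j b)) m

  -- The fuel f only needs to bound the size m.
  treesOfSize : ℕ → ℕ → List (KTree k)
  treesOfSize f       zero    = empty ∷ []
  treesOfSize zero    (suc m) = []
  treesOfSize (suc f) (suc m) = map node (forestsWith (treesOfSize f) k m)

  TreeTable : (ℕ → List (KTree k)) → ℕ → Set
  TreeTable trees m = ∀ a → a ≤ m → Enumerates (trees a) (λ t → size t ≡ a)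

  module _ {trees : ℕ → List (KTree k)} where

    private
      table-left : ∀ {a b m} → TreeTable trees m → a + b ≡ m → TreeTable trees a
      table-left table a+b≡m c c≤a = table c (≤-trans c≤a (subst (_ ≤_) a+b≡m (m≤m+n _ _)))

      table-right : ∀ {a b m} → TreeTable trees m → a + b ≡ m → TreeTable trees b
      table-right table a+b≡m c c≤b = table c (≤-trans c≤b (subst (_ ≤_) a+b≡m (m≤n+m _ _)))

      size∈ : ∀ {a t} → TreeTable trees a → t ∈ trees a → size t ≡ a
      size∈ {a} table t∈ = Equivalence.to (proj₂ (table a ≤-refl) _) t∈

    forestsWith-sizes : ∀ {m} → TreeTable trees m → ∀ {j} {v : Vec (KTree k) j} →
                        v ∈ forestsWith trees j m → sizes v ≡ m
    forestsWith-sizes {zero} table {zero} {[]} v∈ = refl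
    forestsWith-sizes {m}    table {suc j}     v∈ with ∈-concatAntidiagonal⁻ _ m v∈
    ... | a , b , a+b≡m , v∈ab with ∈-cartesianProductWith⁻ _∷_ (trees a) _ v∈ab
    ...   | t , w , t∈ , w∈ , refl =
      trans (cong₂ _+_ (size∈ (table-left table a+b≡m) t∈) (forestsWith-sizes (table-right table a+b≡m) w∈)) a+b≡m

    forestsWith-complete : ∀ {m} → TreeTable trees m → ∀ {j} (v : Vec (KTree k) j) →
                           sizes v ≡ m → v ∈ forestsWith trees j m
    forestsWith-complete table []      refl = here refl
    forestsWith-complete table (t ∷ v) |v|≡m = ∈-concatAntidiagonal⁺ _ |v|≡m
      (∈-cartesianProductWith⁺ _∷_
        (Equivalence.from (proj₂ (table-left table |v|≡m (size t) ≤-refl) t) refl)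
        (forestsWith-complete (table-right table |v|≡m) v refl))

    forestsWith-unique : ∀ {m} → TreeTable trees m → ∀ j → Unique (forestsWith trees j m)
    forestsWith-unique {zero}  table zero    = All.[] ∷ []
    forestsWith-unique {suc m} table zero    = []
    forestsWith-unique {m}     table (suc j) = concatAntidiagonal-unique _ m headSize tagged unique
      where
      headSize : Vec (KTree k) (suc j) → ℕ
      headSize (t ∷ _) = size t
      tagged : ∀ {a b v} → a + b ≡ m → v ∈ cartesianProductWith _∷_ (trees a) (forestsWith trees j b) → headSize v ≡ a
      tagged {a} a+b≡m v∈ with ∈-cartesianProductWith⁻ _∷_ (trees a) _ v∈
      ... | t , w , t∈ , w∈ , refl = size∈ (table-left table a+b≡m) t∈
      unique : ∀ {a b} → a + b ≡ m → Unique (cartesianProductWith _∷_ (trees a) (forestsWith trees j b))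
      unique {a} a+b≡m = cartesianProductWith⁺ _∷_ ∷-injective
        (proj₁ (table-left table a+b≡m a ≤-refl)) (forestsWith-unique (table-right table a+b≡m) j)

  treesOfSize-table : ∀ f → TreeTable (treesOfSize f) f
  treesOfSize-table f       zero    _         = (All.[] ∷ []) , λ t → mk⇔ (size-empty t) (∈-empty t)
    where
    size-empty : ∀ t → t ∈ empty ∷ [] → size t ≡ 0
    size-empty .empty (here refl) = refl
    ∈-empty : ∀ t → size t ≡ 0 → t ∈ empty ∷ []
    ∈-empty empty _ = here refl
  treesOfSize-table (suc f) (suc m) (s≤s m≤f) = map⁺ node-injective (forestsWith-unique table k) ,
    λ t → mk⇔ (size-node t) (∈-node t)
    where
    table : TreeTable (treesOfSize f) m
    table a a≤m = treesOfSize-table f a (≤-trans a≤m m≤f)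
    node-injective : ∀ {v w} → node {k} v ≡ node w → v ≡ w
    node-injective refl = refl
    size-node : ∀ t → t ∈ treesOfSize (suc f) (suc m) → size t ≡ suc m
    size-node t t∈ with ∈-map⁻ node t∈
    ... | v , v∈ , refl = cong suc (forestsWith-sizes table v∈)
    ∈-node : ∀ t → size t ≡ suc m → t ∈ treesOfSize (suc f) (suc m)
    ∈-node (node v) |t|≡1+m = ∈-map⁺ node (forestsWith-complete table v (suc-injective |t|≡1+m))

module HookValues (k-1 x-1 : ℕ) where

  open import Data.Nat as ℕ using (zero; suc; _≤_; s≤s; _!)
  import Data.Nat.Properties as ℕ
  open import Data.Rational using (ℚ; 1ℚ; _÷_; _*_)
  import Data.Rational.Properties as ℚ
  open import Data.List using (List; []; _∷_; map; cartesianProductWith)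
  open import Data.Vec using (Vec; []; _∷_)
  open import Data.Product using (Σ; _×_; _,_)
  open import Function using (_∘_)
  open import Relation.Binary.PropositionalEquality
  open ≡-Reasoning
  open Evaluation
  open Lists
  open ForestNumbers k-1
  open TreeEnumeration k

  x : ℕ
  x = suc x-1

  hookValue : ℕ → ℚ
  hookValue zero    = toℚ x
  hookValue (suc m) = (toℚ (hookNumerator m x) ÷ toℚ (hookDenominator m x))
    {{toℚ-nonZero (hookDenominator m x) {{hookDenominator-nonZero m x-1}}}}

  valueAt-hookFactor : ∀ h → ValueAt (hookFactor k (suc h)) x (hookValue h)
  valueAt-hookFactor zero = valueAt-⁄ (k ℕ.* 1) (eval-cst (k ℕ.* 1) (toℚ x)) (begin
    eval (cst 1 *P lin 0 k) (toℚ x)        ≡⟨ eval-*P (cst 1) (lin 0 k) (toℚ x) ⟩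
    eval (cst 1) (toℚ x) * eval (lin 0 k) (toℚ x)  ≡⟨ cong₂ _*_ (eval-cst 1 (toℚ x)) (eval-lin 0 k x) ⟩
    toℚ 1 * toℚ (k ℕ.* x)                  ≡⟨ toℚ-* 1 (k ℕ.* x) ⟨
    toℚ (1 ℕ.* (k ℕ.* x))
      ≡⟨ cong toℚ (trans (ℕ.*-identityˡ (k ℕ.* x)) (trans (ℕ.*-comm k x) (cong (x ℕ.*_) (sym (ℕ.*-identityʳ k))))) ⟩
    toℚ (x ℕ.* (k ℕ.* 1))                  ≡⟨ toℚ-* x (k ℕ.* 1) ⟩
    toℚ x * toℚ (k ℕ.* 1)                  ∎)
  valueAt-hookFactor (suc m) = valueAt-⁄ (hookDenominator m x)
    {{hookDenominator-nonZero m x-1}}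
    (begin
      eval (cst K *P P) (toℚ x)             ≡⟨ eval-*P (cst K) P (toℚ x) ⟩
      eval (cst K) (toℚ x) * eval P (toℚ x) ≡⟨ cong₂ _*_ (eval-cst K (toℚ x)) (eval-prodRange 1 m (λ i → K ℕ.∸ k ℕ.∸ i) k x) ⟩
      toℚ K * toℚ (prodRangeℕ 1 m (λ i → K ℕ.∸ k ℕ.∸ i ℕ.+ k ℕ.* x))
                                            ≡⟨ toℚ-* K (prodRangeℕ 1 m (λ i → K ℕ.∸ k ℕ.∸ i ℕ.+ k ℕ.* x)) ⟨
      toℚ (hookDenominator m x)             ∎)
    (begin
      eval (prod1 (suc m) (λ i → lin (K ℕ.∸ i) 1)) (toℚ x)  ≡⟨ eval-prodRange 1 (suc m) (λ i → K ℕ.∸ i) 1 x ⟩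
      toℚ (hookNumerator m x)
        ≡⟨ ÷-cross (hookNumerator m x) (hookDenominator m x) (hookDenominator m x) (hookNumerator m x) {{hookDenominator-nonZero m x-1}} refl ⟨
      hookValue (suc m) * toℚ (hookDenominator m x)         ∎)
    where
    K = k ℕ.* suc (suc m)
    P = prod1 m (λ i → lin (K ℕ.∸ k ℕ.∸ i) k)

  hookValue-step : ∀ m → hookValue m * toℚ (forestCount m (k ℕ.* x)) ≡ toℚ (forestCount (suc m) x)
  hookValue-step zero    = trans (ℚ.*-identityʳ (toℚ x)) (cong toℚ (sym (forestCount-1 x)))
  hookValue-step (suc m) = ÷-cross (hookNumerator m x) (hookDenominator m x)
    (forestCount (suc m) (k ℕ.* x)) (forestCount (suc (suc m)) x) {{hookDenominator-nonZero m x-1}} (hook-step m x)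

  mutual
    treeValue : KTree k → ℚ
    treeValue empty     = 1ℚ
    treeValue (node ts) = hookValue (sizes ts) * forestValue ts

    forestValue : ∀ {j} → Vec (KTree k) j → ℚ
    forestValue []       = 1ℚ
    forestValue (t ∷ ts) = treeValue t * forestValue ts

  mutual
    valueAt-hookProd : ∀ t → ValueAt (hookProd t) x (treeValue t)
    valueAt-hookProd empty     = valueAt-1R x
    valueAt-hookProd (node ts) = valueAt-*R
      (valueAt-hookFactor (sizes ts)) (valueAt-hookProds ts)

    valueAt-hookProds : ∀ {j} (ts : Vec (KTree k) j) → ValueAt (hookProds ts) x (forestValue ts)
    valueAt-hookProds []       = valueAt-1R x
    valueAt-hookProds (t ∷ ts) = valueAt-*R (valueAt-hookProd t) (valueAt-hookProds ts)

  valueAt-sumR : ∀ L → ValueAt (sumR (map hookProd L)) x (sumBy treeValue L)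
  valueAt-sumR []      = valueAt-0R x
  valueAt-sumR (t ∷ L) = valueAt-+R (valueAt-hookProd t) (valueAt-sumR L)

  sumBy-forestsWith : ∀ {trees} m → (∀ a → a ≤ m → sumBy treeValue (trees a) ≡ toℚ (forestCount a x)) →
                      ∀ j → sumBy forestValue (forestsWith trees j m) ≡ toℚ (forestCount m (j ℕ.* x))
  sumBy-forestsWith zero    _    zero    = ℚ.+-identityʳ 1ℚ
  sumBy-forestsWith (suc m) _    zero    = refl
  sumBy-forestsWith {trees} m sums (suc j) = trans
    (sumBy-concatAntidiagonal forestValue _ (λ a b → forestCount a x ℕ.* forestCount b (j ℕ.* x)) m block)
    (cong toℚ (forestCount-convolution m x (j ℕ.* x)))
    where
    block : ∀ {a b} → a ℕ.+ b ≡ m →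
            sumBy forestValue (cartesianProductWith _∷_ (trees a) (forestsWith trees j b)) ≡ toℚ (forestCount a x ℕ.* forestCount b (j ℕ.* x))
    block {a} {b} a+b≡m = begin
      sumBy forestValue (cartesianProductWith _∷_ (trees a) (forestsWith trees j b))
        ≡⟨ sumBy-cartesianProductWith _∷_ treeValue forestValue forestValue (λ _ _ → refl) (trees a) _ ⟩
      sumBy treeValue (trees a) * sumBy forestValue (forestsWith trees j b)
        ≡⟨ cong₂ _*_ (sums a (ℕ.m+n≤o⇒m≤o a (ℕ.≤-reflexive a+b≡m)))
                     (sumBy-forestsWith b (λ c c≤b → sums c (ℕ.≤-trans c≤b (ℕ.m+n≤o⇒n≤o a (ℕ.≤-reflexive a+b≡m)))) j) ⟩
      toℚ (forestCount a x) * toℚ (forestCount b (j ℕ.* x))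
        ≡⟨ toℚ-* (forestCount a x) _ ⟨
      toℚ (forestCount a x ℕ.* forestCount b (j ℕ.* x))  ∎

  sumBy-treesOfSize : ∀ f a → a ≤ f → sumBy treeValue (treesOfSize f a) ≡ toℚ (forestCount a x)
  sumBy-treesOfSize f       zero    _         = ℚ.+-identityʳ 1ℚ
  sumBy-treesOfSize (suc f) (suc m) (s≤s m≤f) = begin
    sumBy treeValue (map node forests)              ≡⟨ sumBy-map treeValue node forests ⟩
    sumBy (treeValue ∘ node) forests
      ≡⟨ sumBy-cong forests (λ {v} v∈ → cong (λ s → hookValue s * forestValue v) (forestsWith-sizes table v∈)) ⟩
    sumBy (λ v → hookValue m * forestValue v) forests ≡⟨ sumBy-*ˡ (hookValue m) forestValue forests ⟩
    hookValue m * sumBy forestValue forests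
      ≡⟨ cong (hookValue m *_) (sumBy-forestsWith {treesOfSize f} m (λ a a≤m → sumBy-treesOfSize f a (ℕ.≤-trans a≤m m≤f)) k) ⟩
    hookValue m * toℚ (forestCount m (k ℕ.* x))     ≡⟨ hookValue-step m ⟩
    toℚ (forestCount (suc m) x)                     ∎
    where
    forests = forestsWith (treesOfSize f) k m
    table : TreeTable (treesOfSize f) m
    table a a≤m = treesOfSize-table f a (ℕ.≤-trans a≤m m≤f)

  valueAt-rhs : ∀ m → ValueAt (rhs k (suc m)) x (toℚ (forestCount (suc m) x))
  valueAt-rhs m = valueAt-⁄ (suc m !) {{ℕ._!≢0 (suc m)}} (eval-cst (suc m !) (toℚ x)) (begin
    eval (lin 0 1 *P P) (toℚ x)                       ≡⟨ eval-*P (lin 0 1) P (toℚ x) ⟩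
    eval (lin 0 1) (toℚ x) * eval P (toℚ x)           ≡⟨ cong₂ _*_ (eval-lin 0 1 x) (eval-prodRange 1 m (λ i → k ℕ.* suc m ℕ.∸ i) 1 x) ⟩
    toℚ (0 ℕ.+ 1 ℕ.* x) * toℚ Pℕ                      ≡⟨ toℚ-* (0 ℕ.+ 1 ℕ.* x) Pℕ ⟨
    toℚ ((0 ℕ.+ 1 ℕ.* x) ℕ.* Pℕ)                      ≡⟨ cong toℚ x·P≡closedForm ⟩
    toℚ (forestCount (suc m) x ℕ.* suc m !)           ≡⟨ toℚ-* (forestCount (suc m) x) (suc m !) ⟩
    toℚ (forestCount (suc m) x) * toℚ (suc m !)       ∎)
    where
    P  = prod1 m (λ i → lin (k ℕ.* suc m ℕ.∸ i) 1)
    Pℕ = prodRangeℕ 1 m (λ i → k ℕ.* suc m ℕ.∸ i ℕ.+ 1 ℕ.* x)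
    x·P≡closedForm : (0 ℕ.+ 1 ℕ.* x) ℕ.* Pℕ ≡ forestCount (suc m) x ℕ.* suc m !
    x·P≡closedForm = trans
      (cong₂ ℕ._*_ (ℕ.*-identityˡ x) (prodRangeℕ-cong 1 m (λ i _ _ → cong (k ℕ.* suc m ℕ.∸ i ℕ.+_) (ℕ.*-identityˡ x))))
      (sym (forestCount-closedForm m x))

  valueAt-hookSum : ∀ m {L} → Enumerates L (λ t → size t ≡ suc m) →
                            ValueAt (sumR (map hookProd L)) x (toℚ (forestCount (suc m) x))
  valueAt-hookSum m {L} L-enumerates = subst (ValueAt (sumR (map hookProd L)) x) sum≡ (valueAt-sumR L)
    where
    sum≡ : sumBy treeValue L ≡ toℚ (forestCount (suc m) x)
    sum≡ = trans (sumBy-↭ treeValue (enumerations-↭ L-enumerates (treesOfSize-table (suc m) (suc m) ℕ.≤-refl)))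
                 (sumBy-treesOfSize (suc m) (suc m) ℕ.≤-refl)

  hookSum-rhs-commonValue : ∀ m {L} → Enumerates L (λ t → size t ≡ suc m) →
    Σ ℚ λ V → ValueAt (sumR (map hookProd L)) x V × ValueAt (rhs k (suc m)) x V
  hookSum-rhs-commonValue m L-enumerates =
    toℚ (forestCount (suc m) x) , valueAt-hookSum m L-enumerates , valueAt-rhs m


theorem2p6 : (k : ℕ) → 1 ≤ k → (n : ℕ) → 1 ≤ n →
    (L : List (KTree k)) → Unique L → ((T : KTree k) → (T ∈ L) ⇔ (size T ≡ n)) →
    sumR (map hookProd L) ≈R rhs k n
theorem2p6 (suc k-1) _ (suc m) _ L L-unique L-complete =
  Evaluation.≈R-fromValues (sumR (map hookProd L)) (rhs (suc k-1) (suc m))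
    λ { (suc x-1) _ → HookValues.hookSum-rhs-commonValue k-1 x-1 m (L-unique , L-complete) }
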